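{- Let $\mathcal{S\!\Lambda}$ be the set consisting of all saturated sets $X$ with $\mathcal{B}\subseteq X\subseteq\mathcal{S}$, together with the set $\Lambda$ of all $\lambda$-terms. Consider the generalised intersection type theory $\langle\mathcal{S\!\Lambda},\subseteq\rangle$ with top $\Lambda$, meet $\cap$ and arrow $\Rightarrow$. This gitt is sensible: for every unsolvable $\lambda$-term $M$, every basis $\Upsilon$ and every $X\in\mathcal{S\!\Lambda}$, if $\Upsilon\vdash M:X$ is derivable in the type assignment system induced by this gitt, then $X=\Lambda$.
   Context: $\Lambda$ denotes the set of untyped $\lambda$-terms, with $\beta$-reduction $\to^*_\beta$ and $\beta$-conversion $=_\beta$. A $\lambda$-term $M$ with free variables $\vec x$ is solvable if there are terms $N_1,\dots,N_n$ with $(\lambda\vec x.M)N_1\cdots N_n\to^*_\beta \lambda x.x$; otherwise it is unsolvable (equivalently, its head reduction is infinite). $\mathcal{S}$ is the set of solvable terms, and $\mathcal{B}=\{M\in\Lambda\mid M\to^*_\beta xM_1\cdots M_m \text{ for some variable } x \text{ and terms } M_1,\dots,M_m\}$. A set $X\subseteq\mathcal{S}$ is saturated if it is closed under $\beta$-conversion and contains $xM_1\cdots M_m$ for all variables $x$ and all terms $M_1,\dots,M_m$. For $X,Y$ each either a saturated set or $\Lambda$, $X\Rightarrow Y=\{M\in\Lambda\mid \forall N\in X.\ MN\in Y\}$; $\mathcal{S\!\Lambda}$ is closed under $\cap$ and $\Rightarrow$. A generalised intersection type theory (gitt) is a non-trivial meet-semilattice $\langle\Theta,\sqsubseteq_\Theta\rangle$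 with top $\top_\Theta$, meet $\sqcap_\Theta$, and a binary operation $\rightsquigarrow_\Theta$ on $\Theta$. Its type assignment system derives judgements $\Upsilon\vdash M:\alpha$, where $\alpha\in\Theta$ and the basis $\Upsilon$ is a finite map from term variables to $\Theta$, by the rules: $\Upsilon,x:\alpha\vdash x:\alpha$; $\Upsilon\vdash M:\top_\Theta$; from $\Upsilon,x:\beta\vdash M:\alpha$ infer $\Upsilon\vdash\lambda x.M:\beta\rightsquigarrow_\Theta\alpha$; from $\Upsilon\vdash M:\beta\rightsquigarrow_\Theta\alpha$ and $\Upsilon\vdash N:\beta$ infer $\Upsilon\vdash MN:\alpha$; from $\Upsilon\vdash M:\beta$ and $\Upsilon\vdash M:\alpha$ infer $\Upsilon\vdash M:\beta\sqcap_\Theta\alpha$; from $\Upsilon\vdash M:\beta$ and $\beta\sqsubseteq_\Theta\alpha$ infer $\Upsilon\vdash M:\alpha$. (Writing $\Upsilon,x:\alpha$ assumes $x$ is not in the domain of $\Upsilon$.) A gitt is sensible if every unsolvable term can only be assigned elements equivalent to $\top_\Theta$. -}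

module Defs where

open import Data.Nat using (ℕ; zero; suc; _⊔_; _∸_)
open import Data.List using (List; []; _∷_; foldl)
open import Data.Maybe using (Maybe; just; nothing)
open import Data.Product using (Σ; ∃; ∃-syntax; _×_; _,_; proj₁)
open import Data.Sum using (_⊎_)
open import Data.Unit using (⊤)
open import Relation.Nullary using (¬_)
open import Relation.Binary.Construct.Closure.ReflexiveTransitive using (Star)
open import Relation.Binary.Construct.Closure.Equivalence using (EqClosure)

-- Untyped λ-terms (de Bruijn indices; α-equivalence is syntactic identity)

infixl 7 _·_
data Term : Set where
  var : ℕ → Term
  ƛ   : Term → Term
  _·_ : Term → Term → Term

ext : (ℕ → ℕ) → ℕ → ℕ
ext ρ zero    = zero
ext ρ (suc i) = suc (ρ i)

rename : (ℕ → ℕ) → Term → Term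
rename ρ (var i) = var (ρ i)
rename ρ (ƛ M)   = ƛ (rename (ext ρ) M)
rename ρ (M · N) = rename ρ M · rename ρ N

exts : (ℕ → Term) → ℕ → Term
exts σ zero    = var zero
exts σ (suc i) = rename suc (σ i)

subst : (ℕ → Term) → Term → Term
subst σ (var i) = σ i
subst σ (ƛ M)   = ƛ (subst (exts σ) M)
subst σ (M · N) = subst σ M · subst σ N

subst-zero : Term → ℕ → Term
subst-zero N zero    = N
subst-zero N (suc i) = var i

-- M [ N ] : substitute N for the variable bound by the outer λ of ƛ M
_[_] : Term → Term → Term
M [ N ] = subst (subst-zero N) M

infix 4 _⟶β_
data _⟶β_ : Term → Term → Set where
  β  : ∀ {M N} → (ƛ M) · N ⟶β M [ N ]
  ξ₁ : ∀ {M M' N} → M ⟶β M' → M · N ⟶β M' · N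
  ξ₂ : ∀ {M N N'} → N ⟶β N' → M · N ⟶β M · N'
  ζ  : ∀ {M M'} → M ⟶β M' → ƛ M ⟶β ƛ M'

infix 4 _⟶*β_ _=β_
_⟶*β_ : Term → Term → Set
_⟶*β_ = Star _⟶β_

_=β_ : Term → Term → Set
_=β_ = EqClosure _⟶β_

apps : Term → List Term → Term
apps = foldl _·_

spine : ℕ → List Term → Term
spine x Ms = apps (var x) Ms

ƛⁿ : ℕ → Term → Term
ƛⁿ zero    M = M
ƛⁿ (suc n) M = ƛ (ƛⁿ n M)

-- least k such that every free variable of M has index < k
fvb : Term → ℕ
fvb (var i) = suc i
fvb (ƛ M)   = fvb M ∸ 1
fvb (M · N) = fvb M ⊔ fvb N

I : Term
I = ƛ (var zero)

-- (λ x⃗. M) N₁ ⋯ Nₙ →*β λx.x, where x⃗ are the free variables of M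
Solvable : Term → Set
Solvable M = ∃[ Ns ] (apps (ƛⁿ (fvb M) M) Ns ⟶*β I)

Unsolvable : Term → Set
Unsolvable M = ¬ Solvable M

TSet : Set₁
TSet = Term → Set

infix 4 _⊆_
_⊆_ : TSet → TSet → Set
X ⊆ Y = ∀ {M} → X M → Y M

Λ : TSet
Λ _ = ⊤

𝓑 : TSet
𝓑 M = ∃[ x ] ∃[ Ms ] (M ⟶*β spine x Ms)

Saturated : TSet → Set
Saturated X =
  (∀ {M N} → M =β N → X M → X N) ×
  (∀ x Ms → X (spine x Ms))

Is𝓢𝚲 : TSet → Set
Is𝓢𝚲 X = (∀ M → X M) ⊎ (Saturated X × 𝓑 ⊆ X × X ⊆ Solvable)

𝓢𝚲 : Set₁
𝓢𝚲 = Σ TSet Is𝓢𝚲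

infixr 6 _∩_
_∩_ : TSet → TSet → TSet
(X ∩ Y) M = X M × Y M

infixr 5 _⇒_
_⇒_ : TSet → TSet → TSet
(X ⇒ Y) M = ∀ N → X N → Y (M · N)

-- A basis is a finite map from (de Bruijn) variables to 𝓢𝚲:
-- entry i of the list is the type of variable i (nothing = not in domain;
-- indices beyond the list are not in the domain).
Basis : Set₁
Basis = List (Maybe 𝓢𝚲)

infix 4 _∋_∶_
data _∋_∶_ : Basis → ℕ → TSet → Set₁ where
  here  : ∀ {Υ X} → (just X ∷ Υ) ∋ zero ∶ proj₁ X
  there : ∀ {Υ e i X} → Υ ∋ i ∶ X → (e ∷ Υ) ∋ suc i ∶ X

-- Every rule is instantiated only with types α, β ∈ 𝓢𝚲 (the Is𝓢𝚲 premises).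
infix 3 _⊢_∶_
data _⊢_∶_ (Υ : Basis) : Term → TSet → Set₁ where
  ⊢var  : ∀ {i X} → Υ ∋ i ∶ X → Υ ⊢ var i ∶ X
  ⊢top  : ∀ {M} → Υ ⊢ M ∶ Λ
  ⊢abs  : ∀ {M X Y} (x : Is𝓢𝚲 X) → Is𝓢𝚲 Y →
          (just (X , x) ∷ Υ) ⊢ M ∶ Y → Υ ⊢ ƛ M ∶ (X ⇒ Y)
  ⊢app  : ∀ {M N X Y} → Is𝓢𝚲 X → Is𝓢𝚲 Y →
          Υ ⊢ M ∶ (X ⇒ Y) → Υ ⊢ N ∶ X → Υ ⊢ M · N ∶ Y
  ⊢meet : ∀ {M X Y} → Is𝓢𝚲 X → Is𝓢𝚲 Y →
          Υ ⊢ M ∶ X → Υ ⊢ M ∶ Y → Υ ⊢ M ∶ (X ∩ Y)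
  ⊢sub  : ∀ {M X Y} → Is𝓢𝚲 X → Is𝓢𝚲 Y →
          Υ ⊢ M ∶ X → X ⊆ Y → Υ ⊢ M ∶ Y

{-# OPTIONS --safe #-}
-- Types are read as sets of terms, and a derivation Υ ⊢ M ∶ X is sound for
-- this reading: X contains every instance of M under a substitution sending
-- each variable of Υ into its type. The abstraction rule is sound because
-- every element of 𝓢𝚲 is closed under β-expansion. Variables belong to every
-- element of 𝓢𝚲, so the identity substitution gives M ∈ X; a saturated X
-- contains only solvable terms, hence for unsolvable M the type X is Λ.
module Submission where

open import Defs
open import Data.Nat using (ℕ; zero; suc)
open import Data.List using ([]; _∷_)
open import Data.Maybe using (just)
open import Data.Product using (_,_; proj₂)
open import Data.Sum using (inj₁; inj₂)
open import Data.Empty using (⊥-elim)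
open import Data.Unit using (tt)
open import Function using (_∘_)
open import Relation.Binary.PropositionalEquality
  using (_≡_; _≗_; refl; sym; trans; cong; cong₂) renaming (subst to ≡-subst)
open import Relation.Binary.Construct.Closure.ReflexiveTransitive using (ε; _◅_)
open import Relation.Binary.Construct.Closure.Symmetric using (bwd)

ext-cong : ∀ {ρ ρ'} → ρ ≗ ρ' → ext ρ ≗ ext ρ'
ext-cong e zero    = refl
ext-cong e (suc i) = cong suc (e i)

rename-cong : ∀ {ρ ρ'} → ρ ≗ ρ' → ∀ M → rename ρ M ≡ rename ρ' M
rename-cong e (var i) = cong var (e i)
rename-cong e (ƛ M)   = cong ƛ (rename-cong (ext-cong e) M)
rename-cong e (M · N) = cong₂ _·_ (rename-cong e M) (rename-cong e N)

exts-cong : ∀ {σ σ'} → σ ≗ σ' → exts σ ≗ exts σ'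
exts-cong e zero    = refl
exts-cong e (suc i) = cong (rename suc) (e i)

subst-cong : ∀ {σ σ'} → σ ≗ σ' → ∀ M → subst σ M ≡ subst σ' M
subst-cong e (var i) = e i
subst-cong e (ƛ M)   = cong ƛ (subst-cong (exts-cong e) M)
subst-cong e (M · N) = cong₂ _·_ (subst-cong e M) (subst-cong e N)

rename-rename : ∀ ρ ρ' M → rename ρ (rename ρ' M) ≡ rename (ρ ∘ ρ') M
rename-rename ρ ρ' (var i) = refl
rename-rename ρ ρ' (ƛ M)   = cong ƛ (trans (rename-rename (ext ρ) (ext ρ') M)
  (rename-cong (λ { zero → refl ; (suc i) → refl }) M))
rename-rename ρ ρ' (M · N) = cong₂ _·_ (rename-rename ρ ρ' M) (rename-rename ρ ρ' N)

subst-rename : ∀ σ ρ M → subst σ (rename ρ M) ≡ subst (σ ∘ ρ) M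
subst-rename σ ρ (var i) = refl
subst-rename σ ρ (ƛ M)   = cong ƛ (trans (subst-rename (exts σ) (ext ρ) M)
  (subst-cong (λ { zero → refl ; (suc i) → refl }) M))
subst-rename σ ρ (M · N) = cong₂ _·_ (subst-rename σ ρ M) (subst-rename σ ρ N)

rename-subst : ∀ ρ σ M → rename ρ (subst σ M) ≡ subst (rename ρ ∘ σ) M
rename-subst ρ σ (var i) = refl
rename-subst ρ σ (ƛ M)   = cong ƛ (trans (rename-subst (ext ρ) (exts σ) M)
  (subst-cong (λ { zero → refl
                 ; (suc i) → trans (rename-rename (ext ρ) suc (σ i))
                                   (sym (rename-rename suc ρ (σ i))) }) M))
rename-subst ρ σ (M · N) = cong₂ _·_ (rename-subst ρ σ M) (rename-subst ρ σ N)

subst-subst : ∀ τ σ M → subst τ (subst σ M) ≡ subst (subst τ ∘ σ) M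
subst-subst τ σ (var i) = refl
subst-subst τ σ (ƛ M)   = cong ƛ (trans (subst-subst (exts τ) (exts σ) M)
  (subst-cong (λ { zero → refl
                 ; (suc i) → trans (subst-rename (exts τ) suc (σ i))
                                   (sym (rename-subst suc τ (σ i))) }) M))
subst-subst τ σ (M · N) = cong₂ _·_ (subst-subst τ σ M) (subst-subst τ σ N)

subst-var : ∀ M → subst var M ≡ M
subst-var (var i) = refl
subst-var (ƛ M)   = cong ƛ (trans (subst-cong (λ { zero → refl ; (suc i) → refl }) M)
                                  (subst-var M))
subst-var (M · N) = cong₂ _·_ (subst-var M) (subst-var N)

cons : Term → (ℕ → Term) → ℕ → Term
cons N σ zero    = N
cons N σ (suc i) = σ i

subst-exts-[] : ∀ σ N M → subst (exts σ) M [ N ] ≡ subst (cons N σ) M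
subst-exts-[] σ N M = trans (subst-subst (subst-zero N) (exts σ) M)
  (subst-cong (λ { zero → refl
                 ; (suc i) → trans (subst-rename (subst-zero N) suc (σ i))
                                   (subst-var (σ i)) }) M)

Is𝓢𝚲-=β-closed : ∀ {X} → Is𝓢𝚲 X → ∀ {M N} → M =β N → X M → X N
Is𝓢𝚲-=β-closed (inj₁ total)               _   _  = total _
Is𝓢𝚲-=β-closed (inj₂ ((closed , _) , _)) M=N XM = closed M=N XM

Is𝓢𝚲-var : ∀ {X} → Is𝓢𝚲 X → ∀ i → X (var i)
Is𝓢𝚲-var (inj₁ total)              i = total _
Is𝓢𝚲-var (inj₂ ((_ , spines) , _)) i = spines i []

Is𝓢𝚲-unsolvable : ∀ {X M} → Is𝓢𝚲 X → X M → Unsolvable M → ∀ N → X N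
Is𝓢𝚲-unsolvable (inj₁ total)            _  _     N = total N
Is𝓢𝚲-unsolvable (inj₂ (_ , _ , X⊆𝓢)) XM unsol _ = ⊥-elim (unsol (X⊆𝓢 XM))

∋-Is𝓢𝚲 : ∀ {Υ i X} → Υ ∋ i ∶ X → Is𝓢𝚲 X
∋-Is𝓢𝚲 (here {X = X}) = proj₂ X
∋-Is𝓢𝚲 (there x)      = ∋-Is𝓢𝚲 x

infix 3 _⊨_
_⊨_ : (ℕ → Term) → Basis → Set₁
σ ⊨ Υ = ∀ {i X} → Υ ∋ i ∶ X → X (σ i)

var-⊨ : ∀ Υ → var ⊨ Υ
var-⊨ Υ x = Is𝓢𝚲-var (∋-Is𝓢𝚲 x) _

⊢-sound : ∀ {Υ M X} → Υ ⊢ M ∶ X → ∀ σ → σ ⊨ Υ → X (subst σ M)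
⊢-sound (⊢var x)           σ σ⊨Υ = σ⊨Υ x
⊢-sound ⊢top               σ σ⊨Υ = tt
⊢-sound {Υ} {ƛ M} (⊢abs {X = X} {Y = Y} isX isY d) σ σ⊨Υ N XN =
  Is𝓢𝚲-=β-closed isY (bwd β ◅ ε)
    (≡-subst Y (sym (subst-exts-[] σ N M)) (⊢-sound d (cons N σ) N∷σ⊨))
  where
  N∷σ⊨ : cons N σ ⊨ just (X , isX) ∷ Υ
  N∷σ⊨ here      = XN
  N∷σ⊨ (there x) = σ⊨Υ x
⊢-sound (⊢app _ _ d e)     σ σ⊨Υ = ⊢-sound d σ σ⊨Υ _ (⊢-sound e σ σ⊨Υ)
⊢-sound (⊢meet _ _ d e)    σ σ⊨Υ = ⊢-sound d σ σ⊨Υ , ⊢-sound e σ σ⊨Υ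
⊢-sound (⊢sub _ _ d X⊆Y)   σ σ⊨Υ = X⊆Y (⊢-sound d σ σ⊨Υ)

⊢-sound-id : ∀ {Υ M X} → Υ ⊢ M ∶ X → X M
⊢-sound-id {Υ} {M} {X} d = ≡-subst X (subst-var M) (⊢-sound d var (var-⊨ Υ))

theorem29 : (M : Term) → Unsolvable M → (Υ : Basis) (X : TSet) → Is𝓢𝚲 X →
    (Υ ⊢ M ∶ X) → ∀ N → X N
theorem29 M unsol Υ X isX d = Is𝓢𝚲-unsolvable isX (⊢-sound-id d) unsol
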